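{- Let $n\ge 2$ and let $P_n^c$ be the complement of the path graph $P_n$ on $n$ vertices. Then $\operatorname{bc}(P_n^c)=\lceil\log_2(n-1)\rceil$.
   Context: $\operatorname{bc}(G)$ is the minimum number of complete bipartite subgraphs (bicliques) of $G$ such that every edge of $G$ lies in at least one of them. -}

module Defs where

open import Data.Nat using (ℕ; suc; _+_; _<_; _≤_)
open import Data.Fin using (Fin; toℕ)
open import Data.List using (List)
open import Data.List.Membership.Propositional using (_∈_)
open import Data.Product using (_×_; Σ; ∃)
open import Data.Sum using (_⊎_)
open import Relation.Binary.PropositionalEquality using (_≡_)
open import Relation.Nullary using (¬_)

Graph : ℕ → Set₁
Graph n = Fin n → Fin n → Set

PathAdj : (n : ℕ) → Graph n
PathAdj n i j = (suc (toℕ i) ≡ toℕ j) ⊎ (suc (toℕ j) ≡ toℕ i)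

Complement : {n : ℕ} → Graph n → Graph n
Complement G i j = ¬ (i ≡ j) × ¬ (G i j)

PathComplement : (n : ℕ) → Graph n
PathComplement n = Complement (PathAdj n)

-- A biclique (complete bipartite subgraph) of G: two vertex lists A, B
-- with every a ∈ A adjacent to every b ∈ B (A, B are then disjoint when
-- G is irreflexive).
record Biclique {n : ℕ} (G : Graph n) : Set where
  constructor biclique
  field
    left  : List (Fin n)
    right : List (Fin n)
    complete : ∀ {a b} → a ∈ left → b ∈ right → G a b

open Biclique public

CoversEdge : {n : ℕ} {G : Graph n} → Biclique G → Fin n → Fin n → Set
CoversEdge K u v = (u ∈ left K × v ∈ right K) ⊎ (v ∈ left K × u ∈ right K)

BicliqueCover : {n : ℕ} → Graph n → ℕ → Set
BicliqueCover {n} G k =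
  Σ (Fin k → Biclique G) λ K → ∀ u v → G u v → ∃ λ t → CoversEdge (K t) u v

BicliqueCoverNumber : {n : ℕ} → Graph n → ℕ → Set
BicliqueCoverNumber G m = BicliqueCover G m × (∀ k → k < m → ¬ BicliqueCover G k)

{-# OPTIONS --safe #-}
module Submission where

-- Upper bound: put the vertices of P_{2^k + 1} at 0, …, 2^k. The first
-- biclique has the vertices below the midpoint m = 2^(k-1) on the left and
-- those above it on the right; folding the path at m maps it onto the path
-- 0, …, m and sends adjacent vertices to adjacent or equal ones, so the
-- remaining k - 1 bicliques come from the folded path by recursion.
--
-- Lower bound: label the path edge {i, i+1} by the set of bicliques in which
-- i or i+1 lies on the right side. For i < i' the biclique covering the edge
-- {i, i'+1} of the complement touches exactly one of {i, i+1}, {i', i'+1} on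
-- its right side, so the n - 1 labels are distinct subsets of the k
-- bicliques.

open import Defs
open import Data.Nat using (ℕ; zero; suc; pred; _+_; _∸_; _^_; _≤_; _<_; z≤n; s≤s; s≤s⁻¹; ∣_-_∣; ⌊_/2⌋; ⌈_/2⌉; _≤?_; _<?_)
open import Data.Nat.Properties hiding (_≟_)
open import Data.Nat.Logarithm using (⌈log₂_⌉; ⌈log₂⌉-mono-≤; ⌈log₂2^n⌉≡n)
open import Data.Nat.Logarithm.Core using (⌈log2⌉)
open import Induction.WellFounded using (Acc; acc)
open import Data.Fin using (Fin; toℕ; inject₁; funToFin; finToFun)
import Data.Fin as Fin
import Data.Fin.Properties as Finₚ using (<-cmp)
open import Data.Fin.Properties using (toℕ-injective; toℕ<n; toℕ-inject₁; finToFun-funToFin; injective⇒≤; _≟_)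
open import Data.List using (List; filter; allFin)
open import Data.List.Membership.Propositional using (_∈_)
open import Data.List.Membership.Propositional.Properties using (∈-filter⁺; ∈-filter⁻; ∈-allFin)
open import Data.Product using (∃; _,_; proj₁; proj₂; map₂)
open import Data.Product using () renaming (map to map-Σ)
open import Data.Sum using (_⊎_; inj₁; inj₂)
open import Data.Empty using (⊥-elim)
open import Function using (_∘_; _⇔_; Equivalence; Injective; mk⇔)
open import Relation.Binary using (DecidableEquality; tri<; tri≈; tri>)
open import Relation.Nullary using (¬_; Dec; yes; no)
open import Relation.Nullary.Decidable using (_⊎-dec_)
open import Relation.Unary using (Decidable)
open import Relation.Binary.PropositionalEquality

n≤2^⌈log2⌉n : ∀ n (rec : Acc _<_ n) → n ≤ 2 ^ ⌈log2⌉ n rec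
n≤2^⌈log2⌉n zero          _         = z≤n
n≤2^⌈log2⌉n (suc zero)    _         = s≤s z≤n
n≤2^⌈log2⌉n (suc (suc n)) (acc rs)  = begin
  2 + n                        ≡⟨ cong (2 +_) (sym (⌊n/2⌋+⌈n/2⌉≡n n)) ⟩
  2 + (⌊ n /2⌋ + h)            ≤⟨ s≤s (s≤s (+-monoˡ-≤ h (⌊n/2⌋≤⌈n/2⌉ n))) ⟩
  2 + (h + h)                  ≡⟨ cong suc (sym (+-suc h h)) ⟩
  suc h + suc h                ≤⟨ +-mono-≤ ih ih ⟩
  2 ^ L + 2 ^ L                ≡⟨ cong (2 ^ L +_) (sym (+-identityʳ (2 ^ L))) ⟩
  2 ^ suc L                    ∎
  where
  open ≤-Reasoning
  h = ⌈ n /2⌉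
  L = ⌈log2⌉ (suc h) (rs (⌈n/2⌉<n n))
  ih : suc h ≤ 2 ^ L
  ih = n≤2^⌈log2⌉n (suc h) (rs (⌈n/2⌉<n n))

n≤2^⌈log₂n⌉ : ∀ n → n ≤ 2 ^ ⌈log₂ n ⌉
n≤2^⌈log₂n⌉ n = n≤2^⌈log2⌉n n _

n≤2^k⇒⌈log₂n⌉≤k : ∀ {n} k → n ≤ 2 ^ k → ⌈log₂ n ⌉ ≤ k
n≤2^k⇒⌈log₂n⌉≤k k n≤2^k = ≤-trans (⌈log₂⌉-mono-≤ n≤2^k) (≤-reflexive (⌈log₂2^n⌉≡n k))

Near : ℕ → ℕ → Set
Near u v = u ≡ v ⊎ suc u ≡ v ⊎ suc v ≡ u

near-sym : ∀ {u v} → Near u v → Near v u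
near-sym (inj₁ u≡v)         = inj₁ (sym u≡v)
near-sym (inj₂ (inj₁ adj))  = inj₂ (inj₂ adj)
near-sym (inj₂ (inj₂ adj))  = inj₂ (inj₁ adj)

pred-near : ∀ u → Near (pred u) u
pred-near zero    = inj₁ refl
pred-near (suc u) = inj₂ (inj₁ refl)

near⇒≤suc : ∀ {u v} → Near u v → v ≤ suc u
near⇒≤suc {u}     (inj₁ refl)        = n≤1+n u
near⇒≤suc         (inj₂ (inj₁ refl)) = ≤-refl
near⇒≤suc {v = v} (inj₂ (inj₂ refl)) = m≤n+m v 2

far⇒¬near : ∀ {u v} → 2 + u ≤ v → ¬ Near u v
far⇒¬near gap near = 1+n≰n (≤-trans gap (near⇒≤suc near))

¬near⇒far : ∀ {u v} → ¬ Near u v → 2 + u ≤ v ⊎ 2 + v ≤ u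
¬near⇒far {u} {v} ¬near with <-cmp u v
... | tri< u<v _ _ = inj₁ (≤∧≢⇒< u<v (¬near ∘ inj₂ ∘ inj₁))
... | tri≈ _ u≡v _ = ⊥-elim (¬near (inj₁ u≡v))
... | tri> _ _ v<u = inj₂ (≤∧≢⇒< v<u (¬near ∘ inj₂ ∘ inj₂))

-- Reflection of ℕ in the point m: the identity on [0, m], and v ↦ 2m - v on
-- [m, 2m]; beyond 2m the value is truncated to 0.
reflect : ℕ → ℕ → ℕ
reflect m v = m ∸ ∣ m - v ∣

reflect-≤ : ∀ {m v} → v ≤ m → reflect m v ≡ v
reflect-≤ v≤m = trans (cong (_ ∸_) (m≤n⇒∣n-m∣≡n∸m v≤m)) (m∸[m∸n]≡n v≤m)

reflect-≥ : ∀ {m v} → m ≤ v → reflect m v ≡ m ∸ (v ∸ m)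
reflect-≥ m≤v = cong (_ ∸_) (m≤n⇒∣m-n∣≡n∸m m≤v)

reflect-suc : ∀ {m v} → m ≤ v → reflect m (suc v) ≡ pred (reflect m v)
reflect-suc {m} {v} m≤v = begin
  reflect m (suc v)      ≡⟨ reflect-≥ (m≤n⇒m≤1+n m≤v) ⟩
  m ∸ (suc v ∸ m)        ≡⟨ cong (m ∸_) (+-∸-assoc 1 m≤v) ⟩
  m ∸ suc (v ∸ m)        ≡⟨ pred[m∸n]≡m∸[1+n] m (v ∸ m) ⟨
  pred (m ∸ (v ∸ m))     ≡⟨ cong pred (reflect-≥ m≤v) ⟨
  pred (reflect m v)     ∎
  where open ≡-Reasoning

reflect-suc-near : ∀ m v → Near (reflect m v) (reflect m (suc v))
reflect-suc-near m v with v <? m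
... | yes v<m = inj₂ (inj₁ (trans (cong suc (reflect-≤ (<⇒≤ v<m))) (sym (reflect-≤ v<m))))
... | no v≮m  = subst (Near _) (sym (reflect-suc (≮⇒≥ v≮m))) (near-sym (pred-near _))

reflect-near : ∀ m {u v} → Near u v → Near (reflect m u) (reflect m v)
reflect-near m (inj₁ refl)        = inj₁ refl
reflect-near m (inj₂ (inj₁ refl)) = reflect-suc-near m _
reflect-near m (inj₂ (inj₂ refl)) = near-sym (reflect-suc-near m _)

∸-antitone-2+ : ∀ {m a b} → 2 + a ≤ b → b ≤ m → 2 + (m ∸ b) ≤ m ∸ a
∸-antitone-2+ {a = a} gap b≤m =
  ≤-trans (s≤s (∸-monoʳ-< gap b≤m)) (∸-monoʳ-< (n<1+n a) (≤-trans (n≤1+n _) (≤-trans gap b≤m)))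

reflect-reverses-gap : ∀ {m u v} → m ≤ u → 2 + u ≤ v → v ≤ m + m → 2 + reflect m v ≤ reflect m u
reflect-reverses-gap {m} {u} {v} m≤u gap v≤m+m =
  subst₂ (λ a b → 2 + a ≤ b) (sym (reflect-≥ m≤v)) (sym (reflect-≥ m≤u)) (∸-antitone-2+ gap-above v∸m≤m)
  where
  m≤v : m ≤ v
  m≤v = ≤-trans m≤u (≤-trans (m≤n+m u 2) gap)
  gap-above : 2 + (u ∸ m) ≤ v ∸ m
  gap-above = subst (_≤ v ∸ m) (+-∸-assoc 2 m≤u) (∸-monoˡ-≤ m gap)
  v∸m≤m : v ∸ m ≤ m
  v∸m≤m = subst (v ∸ m ≤_) (m+n∸n≡m m m) (∸-monoˡ-≤ m v≤m+m)

data Side : Set where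
  onLeft onRight onNeither : Side

_≟-side_ : DecidableEquality Side
onLeft    ≟-side onLeft    = yes refl
onRight   ≟-side onRight   = yes refl
onNeither ≟-side onNeither = yes refl
onLeft    ≟-side onRight   = no λ ()
onLeft    ≟-side onNeither = no λ ()
onRight   ≟-side onLeft    = no λ ()
onRight   ≟-side onNeither = no λ ()
onNeither ≟-side onLeft    = no λ ()
onNeither ≟-side onRight   = no λ ()

data Opposite : Side → Side → Set where
  left-right : Opposite onLeft onRight
  right-left : Opposite onRight onLeft

opposite-sym : ∀ {s s'} → Opposite s s' → Opposite s' s
opposite-sym left-right = right-left
opposite-sym right-left = left-right

split : ℕ → ℕ → Side
split m v with <-cmp v m
... | tri< _ _ _ = onLeft
... | tri≈ _ _ _ = onNeither
... | tri> _ _ _ = onRight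

split-left : ∀ {m v} → split m v ≡ onLeft → v < m
split-left {m} {v} _ with <-cmp v m
... | tri< v<m _ _ = v<m

split-right : ∀ {m v} → split m v ≡ onRight → m < v
split-right {m} {v} _ with <-cmp v m
... | tri> _ _ m<v = m<v

split-opposite : ∀ {m u v} → u < m → m < v → Opposite (split m u) (split m v)
split-opposite {m} {u} {v} u<m m<v with <-cmp u m | <-cmp v m
... | tri< _ _ _    | tri> _ _ _    = left-right
... | tri≈ u≮m _ _  | _             = ⊥-elim (u≮m u<m)
... | tri> u≮m _ _  | _             = ⊥-elim (u≮m u<m)
... | tri< _ _ _    | tri< _ _ m≮v  = ⊥-elim (m≮v m<v)
... | tri< _ _ _    | tri≈ _ _ m≮v  = ⊥-elim (m≮v m<v)

-- The t-th biclique of the cover of the path 0, …, 2^k: fold t times, at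
-- 2^(k-1), …, 2^(k-t), then split at 2^(k-t-1).
side : (k : ℕ) → Fin k → ℕ → Side
side (suc k) Fin.zero    v = split (2 ^ k) v
side (suc k) (Fin.suc t) v = side k t (reflect (2 ^ k) v)

side-separates : ∀ k t {u v} → side k t u ≡ onLeft → side k t v ≡ onRight → ¬ Near u v
side-separates (suc k) Fin.zero    u-left v-right =
  far⇒¬near (≤-trans (s≤s (split-left u-left)) (split-right v-right))
side-separates (suc k) (Fin.suc t) u-left v-right =
  side-separates k t u-left v-right ∘ reflect-near (2 ^ k)

side-covers : ∀ k {u v} → 2 + u ≤ v → v ≤ 2 ^ k → ∃ λ t → Opposite (side k t u) (side k t v)
side-covers zero (s≤s (s≤s _)) (s≤s ())
side-covers (suc k) {u} {v} gap v≤2m with v ≤? 2 ^ k | u <? 2 ^ k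
... | yes v≤m | _ = map-Σ Fin.suc unfolded (side-covers k gap v≤m)
  where
  unfolded : ∀ {t} → Opposite (side k t u) (side k t v)
           → Opposite (side k t (reflect (2 ^ k) u)) (side k t (reflect (2 ^ k) v))
  unfolded {t} = subst₂ (λ a b → Opposite (side k t a) (side k t b))
                        (sym (reflect-≤ (≤-trans (m≤n+m u 2) (≤-trans gap v≤m))))
                        (sym (reflect-≤ v≤m))
... | no v≰m | yes u<m = Fin.zero , split-opposite u<m (≰⇒> v≰m)
... | no v≰m | no u≮m = map-Σ Fin.suc opposite-sym (side-covers k folded-gap (m∸n≤m m ∣ m - u ∣))
  where
  m = 2 ^ k
  folded-gap : 2 + reflect m v ≤ reflect m u
  folded-gap = reflect-reverses-gap (≮⇒≥ u≮m) gap (subst (v ≤_) (cong (m +_) (+-identityʳ m)) v≤2m)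

module _ {n k : ℕ} {G : Graph n} (σ : Fin k → Fin n → Side)
         (separated : ∀ t {u v} → σ t u ≡ onLeft → σ t v ≡ onRight → G u v) where

  onSide : Fin k → Side → List (Fin n)
  onSide t s = filter (λ i → σ t i ≟-side s) (allFin n)

  onSide⁻ : ∀ {t s i} → i ∈ onSide t s → σ t i ≡ s
  onSide⁻ {t} {s} = proj₂ ∘ ∈-filter⁻ (λ i → σ t i ≟-side s) {xs = allFin n}

  onSide⁺ : ∀ {t s i} → σ t i ≡ s → i ∈ onSide t s
  onSide⁺ {t} {s} {i} = ∈-filter⁺ (λ i → σ t i ≟-side s) (∈-allFin i)

  sideBiclique : Fin k → Biclique G
  sideBiclique t = biclique (onSide t onLeft) (onSide t onRight)
                            (λ a∈ b∈ → separated t (onSide⁻ a∈) (onSide⁻ b∈))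

  sideBiclique-covers : ∀ {t u v} → Opposite (σ t u) (σ t v) → CoversEdge (sideBiclique t) u v
  sideBiclique-covers {t} {u} {v} opp with σ t u in u-side | σ t v in v-side | opp
  ... | onLeft  | onRight | left-right = inj₁ (onSide⁺ u-side , onSide⁺ v-side)
  ... | onRight | onLeft  | right-left = inj₂ (onSide⁺ v-side , onSide⁺ u-side)

  sides⇒bicliqueCover : (∀ u v → G u v → ∃ λ t → Opposite (σ t u) (σ t v)) → BicliqueCover G k
  sides⇒bicliqueCover covering = sideBiclique , λ u v uv → map₂ sideBiclique-covers (covering u v uv)

pathComplement⇒¬near : ∀ {n} {u v : Fin n} → PathComplement n u v → ¬ Near (toℕ u) (toℕ v)
pathComplement⇒¬near (u≢v , _)  (inj₁ u≡v) = u≢v (toℕ-injective u≡v)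
pathComplement⇒¬near (_ , ¬adj) (inj₂ adj)  = ¬adj adj

¬near⇒pathComplement : ∀ {n} {u v : Fin n} → ¬ Near (toℕ u) (toℕ v) → PathComplement n u v
¬near⇒pathComplement ¬near = ¬near ∘ inj₁ ∘ cong toℕ , ¬near ∘ inj₂

pathComplement-cover : ∀ {n} k → n ≤ suc (2 ^ k) → BicliqueCover (PathComplement n) k
pathComplement-cover {n} k n≤1+2^k = sides⇒bicliqueCover (λ t i → side k t (toℕ i)) separated covering
  where
  separated : ∀ t {u v} → side k t (toℕ u) ≡ onLeft → side k t (toℕ v) ≡ onRight → PathComplement n u v
  separated t u-left v-right = ¬near⇒pathComplement (side-separates k t u-left v-right)

  bounded : (i : Fin n) → toℕ i ≤ 2 ^ k
  bounded i = s≤s⁻¹ (≤-trans (toℕ<n i) n≤1+2^k)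

  covering : ∀ u v → PathComplement n u v → ∃ λ t → Opposite (side k t (toℕ u)) (side k t (toℕ v))
  covering u v uv with ¬near⇒far (pathComplement⇒¬near uv)
  ... | inj₁ gap = side-covers k gap (bounded v)
  ... | inj₂ gap = map₂ opposite-sym (side-covers k gap (bounded u))

indicator : ∀ {p} {P : Set p} → Dec P → Fin 2
indicator (yes _) = Fin.suc Fin.zero
indicator (no _)  = Fin.zero

indicator-≡⇒⇔ : ∀ {p q} {P : Set p} {Q : Set q} (p? : Dec P) (q? : Dec Q) → indicator p? ≡ indicator q? → P ⇔ Q
indicator-≡⇒⇔ (yes p) (yes q) _ = mk⇔ (λ _ → q) (λ _ → p)
indicator-≡⇒⇔ (no ¬p) (no ¬q) _ = mk⇔ (⊥-elim ∘ ¬p) (⊥-elim ∘ ¬q)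

funToFin-≡⇒≗ : ∀ {m n} {f g : Fin m → Fin n} → funToFin f ≡ funToFin g → ∀ i → f i ≡ g i
funToFin-≡⇒≗ {f = f} {g} f≡g i = begin
  f i                     ≡⟨ finToFun-funToFin f i ⟨
  finToFun (funToFin f) i ≡⟨ cong (λ c → finToFun c i) f≡g ⟩
  finToFun (funToFin g) i ≡⟨ finToFun-funToFin g i ⟩
  g i                     ∎
  where open ≡-Reasoning

module _ {n : ℕ} (K : Biclique (PathComplement (suc n))) where
  open import Data.List.Membership.DecPropositional (_≟_ {suc n}) using (_∈?_)

  TouchesRight : Fin n → Set
  TouchesRight i = inject₁ i ∈ right K ⊎ Fin.suc i ∈ right K

  touchesRight? : Decidable TouchesRight
  touchesRight? i = (inject₁ i ∈? right K) ⊎-dec (Fin.suc i ∈? right K)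

  covers-gap⇒¬⇔ : ∀ {i i'} → CoversEdge K (inject₁ i) (Fin.suc i') → ¬ (TouchesRight i ⇔ TouchesRight i')
  covers-gap⇒¬⇔ {i} (inj₁ (i∈L , i'+1∈R)) i⇔i' with Equivalence.from i⇔i' (inj₂ i'+1∈R)
  ... | inj₁ i∈R   = proj₁ (complete K i∈L i∈R) refl
  ... | inj₂ i+1∈R = proj₂ (complete K i∈L i+1∈R) (inj₁ (cong suc (toℕ-inject₁ i)))
  covers-gap⇒¬⇔ {i' = i'} (inj₂ (i'+1∈L , i∈R)) i⇔i' with Equivalence.to i⇔i' (inj₁ i∈R)
  ... | inj₁ i'∈R   = proj₂ (complete K i'+1∈L i'∈R) (inj₂ (cong suc (toℕ-inject₁ i')))
  ... | inj₂ i'+1∈R = proj₁ (complete K i'+1∈L i'+1∈R) refl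

gap-edge : ∀ {n} {i i' : Fin n} → i Fin.< i' → PathComplement (suc n) (inject₁ i) (Fin.suc i')
gap-edge {i = i} i<i' = ¬near⇒pathComplement (far⇒¬near (s≤s (subst (_< _) (sym (toℕ-inject₁ i)) i<i')))

module _ {n j : ℕ} (K : Fin j → Biclique (PathComplement (suc n))) where

  gapCode : Fin n → Fin (2 ^ j)
  gapCode i = funToFin (λ t → indicator (touchesRight? (K t) i))

  module _ (covers : ∀ u v → PathComplement (suc n) u v → ∃ λ t → CoversEdge (K t) u v) where

    gapCode-<⇒≢ : ∀ {i i'} → i Fin.< i' → gapCode i ≢ gapCode i'
    gapCode-<⇒≢ {i} {i'} i<i' same =
      let t , covered = covers _ _ (gap-edge i<i') in
      covers-gap⇒¬⇔ (K t) covered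
        (indicator-≡⇒⇔ (touchesRight? (K t) i) (touchesRight? (K t) i') (funToFin-≡⇒≗ same t))

    gapCode-injective : Injective _≡_ _≡_ gapCode
    gapCode-injective {i} {i'} same with Finₚ.<-cmp i i'
    ... | tri< i<i' _ _ = ⊥-elim (gapCode-<⇒≢ i<i' same)
    ... | tri≈ _ i≡i' _ = i≡i'
    ... | tri> _ _ i'<i = ⊥-elim (gapCode-<⇒≢ i'<i (sym same))

pathComplement-cover-size : ∀ {n j} → BicliqueCover (PathComplement (suc n)) j → n ≤ 2 ^ j
pathComplement-cover-size (K , covers) = injective⇒≤ (gapCode-injective K covers)

mainTheorem12 : (n : ℕ) → 2 ≤ n → BicliqueCoverNumber (PathComplement n) ⌈log₂ (n ∸ 1) ⌉
mainTheorem12 (suc n) _ =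
    pathComplement-cover ⌈log₂ n ⌉ (s≤s (n≤2^⌈log₂n⌉ n))
  , λ j j<⌈log₂n⌉ cover → <⇒≱ j<⌈log₂n⌉ (n≤2^k⇒⌈log₂n⌉≤k j (pathComplement-cover-size cover))
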